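{- Let $t\ge1$ be an integer, let $C,p>0$, and let $G$ be an $n$-vertex graph containing at least $3Cn^{t+1}p^t$ copies of the star $S_t$ (with $t$ edges). Then there exist a nonempty collection $\mathcal{H}$ of copies of $S_t$ in $G$ and sets $\mathcal{L}_1,\mathcal{L}_2$ of vertices of $G$ such that (1) every copy of $S_t$ in $\mathcal{H}$ has its center in $\mathcal{L}_1$ and its leaves in $\mathcal{L}_2$, and $|\mathcal{H}|\ge Cn^{t+1}p^t$; (2) every vertex of $\mathcal{L}_1$ is the center of at least $Cn^tp^t$ copies of $S_t$ in $\mathcal{H}$; and (3) every vertex of $\mathcal{L}_2$ is a leaf of at least $Cn^tp^t$ copies of $S_t$ in $\mathcal{H}$.
   Formalization: The constants C and p range over the positive rationals. -}

module Defs where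

open import Data.Bool using (Bool; true; false; T)
open import Data.Nat as ℕ using (ℕ; zero; suc)
open import Data.Integer using (+_)
open import Data.Rational using (ℚ; 1ℚ; _*_; _/_)
open import Data.Fin using (Fin)
open import Data.Fin.Subset using (Subset; _∈_; _⊆_; ∣_∣)
open import Data.Fin.Subset.Properties using (_⊆?_)
open import Data.Vec using (Vec; []; _∷_; tabulate)
open import Data.List using (List; []; _∷_; map; _++_; concatMap; length; filter)
open import Data.List as List using (allFin)
open import Data.Product using (_×_; _,_)
open import Relation.Binary.PropositionalEquality using (_≡_)
open import Relation.Nullary using (Dec)
open import Relation.Nullary.Decidable using (_×-dec_)

record SimpleGraph (n : ℕ) : Set where
  field
    adj   : Fin n → Fin n → Bool
    sym   : ∀ u v → adj u v ≡ adj v u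
    irrfl : ∀ v → adj v v ≡ false
open SimpleGraph public

N : ∀ {n} → SimpleGraph n → Fin n → Subset n
N G v = tabulate (adj G v)

IsStar : ∀ {n} → SimpleGraph n → ℕ → Fin n → Subset n → Set
IsStar G t v L = (L ⊆ N G v) × (∣ L ∣ ≡ t)

isStar? : ∀ {n} (G : SimpleGraph n) t v L → Dec (IsStar G t v L)
isStar? G t v L = (L ⊆? N G v) ×-dec (∣ L ∣ ℕ.≟ t)

allSubsets : ∀ n → List (Subset n)
allSubsets zero = [] ∷ []
allSubsets (suc n) = map (true ∷_) (allSubsets n) ++ map (false ∷_) (allSubsets n)

allPairs : ∀ n → List (Fin n × Subset n)
allPairs n = concatMap (λ v → map (v ,_) (allSubsets n)) (allFin n)

Collection : ℕ → Set
Collection n = Fin n → Subset n → Bool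

#stars : ∀ {n} → SimpleGraph n → ℕ → ℕ
#stars {n} G t = length (filter (λ { (v , L) → isStar? G t v L }) (allPairs n))

size : ∀ {n} → Collection n → ℕ
size {n} H = length (filter (λ { (v , L) → Data.Bool._≟_ (H v L) true }) (allPairs n))
  where import Data.Bool

#centeredAt : ∀ {n} → Collection n → Fin n → ℕ
#centeredAt {n} H v = length (filter (λ L → Data.Bool._≟_ (H v L) true) (allSubsets n))
  where import Data.Bool

#leafAt : ∀ {n} → Collection n → Fin n → ℕ
#leafAt {n} H u =
  length (filter (λ { (v , L) → (Data.Bool._≟_ (H v L) true) ×-dec (u ∈? L) }) (allPairs n))
  where
    import Data.Bool
    open import Data.Fin.Subset.Properties using (_∈?_)

ℕ→ℚ : ℕ → ℚ
ℕ→ℚ n = + n / 1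

_^ℚ_ : ℚ → ℕ → ℚ
x ^ℚ zero = 1ℚ
x ^ℚ suc k = x * (x ^ℚ k)

{-# OPTIONS --safe #-}
module Submission where

-- Put b = ⌊C n^t p^t⌋. Starting from all copies of S_t, repeatedly discard all remaining copies
-- centred at a vertex, or having a vertex as a leaf, whenever that vertex is the centre (resp. a
-- leaf) of between 1 and b remaining copies. Each of these 2n vertex tests fires at most once,
-- because its count is 0 afterwards, so at most 2n b ≤ 2 C n^(t+1) p^t copies are lost and at least
-- C n^(t+1) p^t survive. At the end every count is 0 or above b, hence at least C n^t p^t, and
-- L₁, L₂ are the vertices that are centres, resp. leaves, of some surviving copy.

open import Defs hiding (sym)
open import Data.Bool using (Bool; true; false; _∧_; not; if_then_else_)
import Data.Bool as Bool
open import Data.Bool.Properties using (∧-zeroʳ; ∧-identityʳ)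
open import Data.Nat as ℕ using (ℕ; zero; suc; _≥_; z≤n; s≤s; z<s; _<ᵇ_; _<?_; _≤?_)
open import Data.Nat.Properties
  using (+-identityʳ; *-identityʳ; +-suc; +-assoc; +-comm; +-mono-≤; +-monoˡ-<; ≤-trans; ≤-reflexive;
         <-≤-trans; ≤-pred; m≤m+n; m≤n⇒m≤1+n; n≤0⇒n≡0; ≰⇒>; ≮⇒≥; <⇒≱; module ≤-Reasoning)
open import Data.Nat.DivMod using (_/_; m/n*n≤m; m%n<n; m≡m%n+[m/n]*n)
open import Data.Nat.ListAction using (sum)
open import Data.Integer as ℤ using (-[1+_]; +≤+; +<+)
import Data.Integer.Properties as ℤ
open import Data.Integer.Properties using (pos-*)
open import Data.Nat.Coprimality using (Coprime; 1-coprimeTo) renaming (sym to coprime-sym)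
open import Data.Rational as ℚ using (ℚ; mkℚ; 0ℚ; 1ℚ; _<_; _≤_; _*_; _+_; -_; *≤*; *<*; positive; nonNegative)
import Data.Rational.Properties as ℚ
open import Data.Rational.Properties
  using (normalize-coprime; positive⁻¹; pos*pos⇒pos; *-monoˡ-≤-nonNeg)
open import Data.Rational.Solver using (module +-*-Solver)
open import Data.Fin using (Fin; _≟_)
import Data.Fin as Fin
open import Data.Fin.Properties using (suc-injective)
open import Data.Fin.Subset using (Subset; _∈_; _⊆_)
open import Data.Fin.Subset.Properties using (_∈?_)
open import Data.List using (List; []; _∷_; _++_; map; concatMap; filter; length; tabulate; allFin)
open import Data.List.Properties using (map-tabulate; length-++; length-map; length-tabulate)
open import Data.List.Membership.Propositional using (find; lose) renaming (_∈_ to _∈ˡ_)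
open import Data.List.Membership.Propositional.Properties
  using (∈-map⁺; ∈-++⁺ˡ; ∈-++⁺ʳ; ∈-concatMap⁺; ∈-allFin)
open import Data.List.Relation.Unary.Any using (Any; here; there; any?)
import Data.List.Relation.Unary.Any as Any
import Data.Vec as Vec
open import Data.Vec.Properties using (lookup∘tabulate; lookup⇒[]=; []=⇒lookup)
open import Data.Product using (Σ-syntax; _×_; _,_; proj₁; curry; uncurry)
open import Data.Sum using (_⊎_; inj₁; inj₂)
open import Function using (_∘_; id)
open import Relation.Binary.PropositionalEquality
  using (_≡_; _≢_; refl; sym; trans; cong; cong₂; subst; subst₂; module ≡-Reasoning)
open import Relation.Nullary using (¬_; Dec; does; yes; no; contradiction)
open import Relation.Nullary.Decidable using (_×-dec_; dec-true; dec-false)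
open import Relation.Unary using (Pred; Decidable)
open import Level using (0ℓ)

module _ {A : Set} where

  infix 4 _⊆ᵇ_
  infixl 7 _∩_ _∖_

  _⊆ᵇ_ : (A → Bool) → (A → Bool) → Set
  p ⊆ᵇ q = ∀ a → p a ≡ true → q a ≡ true

  _∩_ _∖_ : (A → Bool) → (A → Bool) → A → Bool
  (p ∩ q) a = p a ∧ q a
  (p ∖ q) a = p a ∧ not (q a)

  ∖-⊆ : ∀ p q → p ∖ q ⊆ᵇ p
  ∖-⊆ p q a e with p a
  ... | true = refl

  count : (A → Bool) → List A → ℕ
  count p [] = 0
  count p (x ∷ xs) = if p x then suc (count p xs) else count p xs

  count-≤-length : ∀ p xs → count p xs ℕ.≤ length xs
  count-≤-length p [] = z≤n
  count-≤-length p (x ∷ xs) with p x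
  ... | true  = s≤s (count-≤-length p xs)
  ... | false = m≤n⇒m≤1+n (count-≤-length p xs)

  count-cong : ∀ {p q} → (∀ a → p a ≡ q a) → ∀ xs → count p xs ≡ count q xs
  count-cong p≗q [] = refl
  count-cong {p} {q} p≗q (x ∷ xs) rewrite p≗q x = cong (λ c → if q x then suc c else c) (count-cong p≗q xs)

  count-≡0 : ∀ {p} → (∀ a → p a ≡ false) → ∀ xs → count p xs ≡ 0
  count-≡0 p≡false [] = refl
  count-≡0 p≡false (x ∷ xs) rewrite p≡false x = count-≡0 p≡false xs

  count-mono : ∀ {p q} → p ⊆ᵇ q → ∀ xs → count p xs ℕ.≤ count q xs
  count-mono p⊆q [] = z≤n
  count-mono {p} {q} p⊆q (x ∷ xs) with p x in px | q x in qx
  ... | true  | true  = s≤s (count-mono p⊆q xs)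
  ... | true  | false = contradiction (trans (sym (p⊆q x px)) qx) λ ()
  ... | false | true  = m≤n⇒m≤1+n (count-mono p⊆q xs)
  ... | false | false = count-mono p⊆q xs

  count-pos : ∀ {p x xs} → x ∈ˡ xs → p x ≡ true → 0 ℕ.< count p xs
  count-pos {p} {x} {y ∷ xs} (here refl) px rewrite px = z<s
  count-pos {p} {x} {y ∷ xs} (there x∈xs) px with p y
  ... | true  = z<s
  ... | false = count-pos x∈xs px

  count-strict : ∀ {p q x xs} → p ⊆ᵇ q → x ∈ˡ xs → p x ≡ false → q x ≡ true →
                 count p xs ℕ.< count q xs
  count-strict {p} {q} {x} {y ∷ xs} p⊆q (here refl) px qx rewrite px | qx = s≤s (count-mono p⊆q xs)
  count-strict {p} {q} {x} {y ∷ xs} p⊆q (there x∈xs) px qx with p y in py | q y in qy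
  ... | true  | true  = s≤s (count-strict p⊆q x∈xs px qx)
  ... | true  | false = contradiction (trans (sym (p⊆q y py)) qy) λ ()
  ... | false | true  = m≤n⇒m≤1+n (count-strict p⊆q x∈xs px qx)
  ... | false | false = count-strict p⊆q x∈xs px qx

  count-witness : ∀ {p} xs → 0 ℕ.< count p xs → Σ[ x ∈ A ] p x ≡ true
  count-witness {p} (x ∷ xs) 0<count with p x in px
  ... | true  = x , px
  ... | false = count-witness xs 0<count

  count-∖-∩ : ∀ p q xs → count p xs ≡ count (p ∖ q) xs ℕ.+ count (p ∩ q) xs
  count-∖-∩ p q [] = refl
  count-∖-∩ p q (x ∷ xs) with p x | q x
  ... | true  | true  = trans (cong suc (count-∖-∩ p q xs)) (sym (+-suc _ _))
  ... | true  | false = cong suc (count-∖-∩ p q xs)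
  ... | false | _     = count-∖-∩ p q xs

  count-++ : ∀ p xs ys → count p (xs ++ ys) ≡ count p xs ℕ.+ count p ys
  count-++ p [] ys = refl
  count-++ p (x ∷ xs) ys with p x
  ... | true  = cong suc (count-++ p xs ys)
  ... | false = count-++ p xs ys

  length-filter≡count : ∀ {ℓ} {P : Pred A ℓ} {P? : Decidable P} {p} →
                        (∀ a → does (P? a) ≡ p a) → ∀ xs → length (filter P? xs) ≡ count p xs
  length-filter≡count agree [] = refl
  length-filter≡count {P? = P?} {p} agree (x ∷ xs) with does (P? x) | p x | agree x
  ... | true  | .true  | refl = cong suc (length-filter≡count agree xs)
  ... | false | .false | refl = length-filter≡count agree xs

count-map : ∀ {A B : Set} (p : B → Bool) (f : A → B) xs → count p (map f xs) ≡ count (p ∘ f) xs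
count-map p f [] = refl
count-map p f (x ∷ xs) = cong (λ c → if p (f x) then suc c else c) (count-map p f xs)

count-concatMap : ∀ {A B : Set} (p : B → Bool) (f : A → List B) xs →
                  count p (concatMap f xs) ≡ sum (map (count p ∘ f) xs)
count-concatMap p f [] = refl
count-concatMap p f (x ∷ xs) =
  trans (count-++ p (f x) (concatMap f xs)) (cong (count p (f x) ℕ.+_) (count-concatMap p f xs))

sum-tabulate-point : ∀ {n} (g : Fin n → ℕ) v → (∀ w → w ≢ v → g w ≡ 0) → sum (tabulate g) ≡ g v
sum-tabulate-point {suc n} g Fin.zero off-v =
  trans (cong (g Fin.zero ℕ.+_) (sum-tabulate-zero (g ∘ Fin.suc) (λ w → off-v (Fin.suc w) λ ())))
        (+-identityʳ (g Fin.zero))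
  where
  sum-tabulate-zero : ∀ {m} (h : Fin m → ℕ) → (∀ w → h w ≡ 0) → sum (tabulate h) ≡ 0
  sum-tabulate-zero {zero} h h≡0 = refl
  sum-tabulate-zero {suc m} h h≡0 rewrite h≡0 Fin.zero = sum-tabulate-zero (h ∘ Fin.suc) (h≡0 ∘ Fin.suc)
sum-tabulate-point {suc n} g (Fin.suc v) off-v rewrite off-v Fin.zero (λ ()) =
  sum-tabulate-point (g ∘ Fin.suc) v (λ w w≢v → off-v (Fin.suc w) (w≢v ∘ suc-injective))

0<⇒0<ᵇ : ∀ {n} → 0 ℕ.< n → (0 <ᵇ n) ≡ true
0<⇒0<ᵇ {suc _} _ = refl

0<ᵇ⇒0< : ∀ {n} → (0 <ᵇ n) ≡ true → 0 ℕ.< n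
0<ᵇ⇒0< {suc _} _ = z<s

module Peeling {A : Set} (xs : List A) (tests : List (A → Bool)) (b : ℕ) where

  weight : (A → Bool) → (A → Bool) → ℕ
  weight H j = count (H ∩ j) xs

  Light : (A → Bool) → Pred (A → Bool) 0ℓ
  Light H j = 0 ℕ.< weight H j × weight H j ℕ.≤ b

  light? : ∀ H → Decidable (Light H)
  light? H j = (0 <? weight H j) ×-dec (weight H j ≤? b)

  Robust : (A → Bool) → Set
  Robust H = ∀ j → j ∈ˡ tests → weight H j ≡ 0 ⊎ b ℕ.< weight H j

  active : (A → Bool) → ℕ
  active H = count (λ j → 0 <ᵇ weight H j) tests

  record Core (H : A → Bool) (loss : ℕ) : Set where
    field
      core      : A → Bool
      core⊆H    : core ⊆ᵇ H
      robust    : Robust core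
      size-core : count H xs ℕ.≤ count core xs ℕ.+ loss

  ¬light⇒robust : ∀ {H} → ¬ Any (Light H) tests → Robust H
  ¬light⇒robust {H} none j j∈ with weight H j ≤? b
  ... | no  w≰b = inj₂ (≰⇒> w≰b)
  ... | yes w≤b = inj₁ (n≤0⇒n≡0 (≮⇒≥ λ w>0 → none (lose j∈ (w>0 , w≤b))))

  weight-∖-self : ∀ H j → weight (H ∖ j) j ≡ 0
  weight-∖-self H j = count-≡0 (λ a → disjoint (H a) (j a)) xs
    where
    disjoint : ∀ h i → (h ∧ not i) ∧ i ≡ false
    disjoint true  true  = refl
    disjoint true  false = refl
    disjoint false _     = refl

  weight-∖-≤ : ∀ H j i → weight (H ∖ j) i ℕ.≤ weight H i
  weight-∖-≤ H j i = count-mono (λ a e → shrink (H a) (j a) (i a) e) xs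
    where
    shrink : ∀ h k l → (h ∧ not k) ∧ l ≡ true → h ∧ l ≡ true
    shrink true false true _ = refl

  active-∖ : ∀ {H j} → j ∈ˡ tests → 0 ℕ.< weight H j → active (H ∖ j) ℕ.< active H
  active-∖ {H} {j} j∈ w>0 = count-strict still-active j∈ j-inactive (0<⇒0<ᵇ w>0)
    where
    still-active : (λ i → 0 <ᵇ weight (H ∖ j) i) ⊆ᵇ (λ i → 0 <ᵇ weight H i)
    still-active i e = 0<⇒0<ᵇ (<-≤-trans (0<ᵇ⇒0< e) (weight-∖-≤ H j i))
    j-inactive : (0 <ᵇ weight (H ∖ j) j) ≡ false
    j-inactive = cong (0 <ᵇ_) (weight-∖-self H j)

  peel-light : ∀ {H j loss} → Light H j → Core (H ∖ j) loss → Core H (b ℕ.+ loss)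
  peel-light {H} {j} {loss} (_ , w≤b) c = record
    { core      = core
    ; core⊆H    = λ a e → ∖-⊆ H j a (core⊆H a e)
    ; robust    = robust
    ; size-core = begin
        count H xs                               ≡⟨ count-∖-∩ H j xs ⟩
        count (H ∖ j) xs ℕ.+ weight H j          ≤⟨ +-mono-≤ size-core w≤b ⟩
        count core xs ℕ.+ loss ℕ.+ b             ≡⟨ +-assoc (count core xs) loss b ⟩
        count core xs ℕ.+ (loss ℕ.+ b)           ≡⟨ cong (count core xs ℕ.+_) (+-comm loss b) ⟩
        count core xs ℕ.+ (b ℕ.+ loss)           ∎
    }
    where
    open Core c
    open ≤-Reasoning

  -- Peeling a test makes its weight 0 for good, so k bounds the number of remaining steps.
  peel : ∀ k H → active H ℕ.≤ k → Core H (k ℕ.* b)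
  peel k H _ with any? (light? H) tests
  peel k H _ | no none = record
    { core = H ; core⊆H = λ _ → id ; robust = ¬light⇒robust none ; size-core = m≤m+n _ _ }
  peel zero H active≤0 | yes some =
    let (j , j∈ , (w>0 , _)) = find some
    in  contradiction active≤0 (<⇒≱ (count-pos j∈ (0<⇒0<ᵇ w>0)))
  peel (suc k) H active≤1+k | yes some =
    let (j , j∈ , light) = find some
    in  peel-light light (peel k (H ∖ j) (≤-pred (<-≤-trans (active-∖ j∈ (proj₁ light)) active≤1+k)))

  robust-core : ∀ H → Core H (length tests ℕ.* b)
  robust-core H = peel (length tests) H (count-≤-length _ tests)

∈-allSubsets : ∀ {n} (L : Subset n) → L ∈ˡ allSubsets n
∈-allSubsets Vec.[] = here refl
∈-allSubsets (true Vec.∷ L) = ∈-++⁺ˡ (∈-map⁺ (true Vec.∷_) (∈-allSubsets L))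
∈-allSubsets {suc n} (false Vec.∷ L) =
  ∈-++⁺ʳ (map (true Vec.∷_) (allSubsets n)) (∈-map⁺ (false Vec.∷_) (∈-allSubsets L))

∈-allPairs : ∀ {n} (v : Fin n) (L : Subset n) → (v , L) ∈ˡ allPairs n
∈-allPairs {n} v L =
  ∈-concatMap⁺ (λ w → map (w ,_) (allSubsets n)) (Any.map (λ { refl → ∈-map⁺ (v ,_) (∈-allSubsets L) }) (∈-allFin v))

does-≟-true : ∀ x → does (x Bool.≟ true) ≡ x
does-≟-true true  = refl
does-≟-true false = refl

module _ {n : ℕ} where

  centredAt hasLeaf : Fin n → Fin n × Subset n → Bool
  centredAt v (w , _) = does (w ≟ v)
  hasLeaf u (_ , L) = does (u ∈? L)

  vertexTests : List (Fin n × Subset n → Bool)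
  vertexTests = map centredAt (allFin n) ++ map hasLeaf (allFin n)

  length-vertexTests : length vertexTests ≡ n ℕ.+ n
  length-vertexTests = trans (length-++ (map centredAt (allFin n)))
    (cong₂ ℕ._+_ (trans (length-map centredAt (allFin n)) (length-tabulate {n = n} id))
                 (trans (length-map hasLeaf (allFin n)) (length-tabulate {n = n} id)))

  size≡count : ∀ (H : Collection n) → size H ≡ count (uncurry H) (allPairs n)
  size≡count H = length-filter≡count (λ { (v , L) → does-≟-true (H v L) }) (allPairs n)

  #centeredAt≡count : ∀ (H : Collection n) v → #centeredAt H v ≡ count (H v) (allSubsets n)
  #centeredAt≡count H v = length-filter≡count (λ L → does-≟-true (H v L)) (allSubsets n)

  #leafAt≡count : ∀ (H : Collection n) u → #leafAt H u ≡ count (uncurry H ∩ hasLeaf u) (allPairs n)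
  #leafAt≡count H u =
    length-filter≡count (λ { (v , L) → cong (_∧ does (u ∈? L)) (does-≟-true (H v L)) }) (allPairs n)

  count-centredAt : ∀ (H : Collection n) v →
                    count (uncurry H ∩ centredAt v) (allPairs n) ≡ #centeredAt H v
  count-centredAt H v = begin
    count (uncurry H ∩ centredAt v) (allPairs n)
      ≡⟨ count-concatMap (uncurry H ∩ centredAt v) (λ w → map (w ,_) (allSubsets n)) (allFin n) ⟩
    sum (map centredCount (allFin n))
      ≡⟨ cong sum (map-tabulate id centredCount) ⟩
    sum (tabulate centredCount)
      ≡⟨ sum-tabulate-point centredCount v off-v ⟩
    centredCount v
      ≡⟨ count-map (uncurry H ∩ centredAt v) (v ,_) (allSubsets n) ⟩
    count (λ L → H v L ∧ does (v ≟ v)) (allSubsets n)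
      ≡⟨ count-cong (λ L → trans (cong (H v L ∧_) (dec-true (v ≟ v) refl)) (∧-identityʳ (H v L))) (allSubsets n) ⟩
    count (H v) (allSubsets n)
      ≡⟨ sym (#centeredAt≡count H v) ⟩
    #centeredAt H v ∎
    where
    open ≡-Reasoning
    centredCount : Fin n → ℕ
    centredCount w = count (uncurry H ∩ centredAt v) (map (w ,_) (allSubsets n))
    off-v : ∀ w → w ≢ v → centredCount w ≡ 0
    off-v w w≢v = trans (count-map (uncurry H ∩ centredAt v) (w ,_) (allSubsets n))
      (count-≡0 (λ L → trans (cong (H w L ∧_) (dec-false (w ≟ v) w≢v)) (∧-zeroʳ (H w L))) (allSubsets n))

  record Pruned (H₀ : Collection n) (b : ℕ) : Set where
    field
      kept    : Collection n
      kept⊆H₀ : ∀ v L → kept v L ≡ true → H₀ v L ≡ true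
      centres : ∀ v → #centeredAt kept v ≡ 0 ⊎ b ℕ.< #centeredAt kept v
      leaves  : ∀ u → #leafAt kept u ≡ 0 ⊎ b ℕ.< #leafAt kept u
      loss    : size H₀ ℕ.≤ size kept ℕ.+ (n ℕ.+ n) ℕ.* b

  prune : ∀ (H₀ : Collection n) (b : ℕ) → Pruned H₀ b
  prune H₀ b = record
    { kept    = curry core
    ; kept⊆H₀ = curry core⊆H
    ; centres = λ v → subst (λ k → k ≡ 0 ⊎ b ℕ.< k) (count-centredAt (curry core) v)
                  (robust (centredAt v) (∈-++⁺ˡ (∈-map⁺ centredAt (∈-allFin v))))
    ; leaves  = λ u → subst (λ k → k ≡ 0 ⊎ b ℕ.< k) (sym (#leafAt≡count (curry core) u))
                  (robust (hasLeaf u) (∈-++⁺ʳ (map centredAt (allFin n)) (∈-map⁺ hasLeaf (∈-allFin u))))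
    ; loss    = subst₂ (λ s s′ → s ℕ.≤ s′ ℕ.+ (n ℕ.+ n) ℕ.* b) (sym (size≡count H₀)) (sym (size≡count (curry core)))
                  (subst (λ m → count (uncurry H₀) (allPairs n) ℕ.≤ count core (allPairs n) ℕ.+ m ℕ.* b)
                    length-vertexTests size-core)
    }
    where
    open Peeling (allPairs n) vertexTests b
    open Core (robust-core (uncurry H₀))

dec-true⁻¹ : ∀ {P : Set} (P? : Dec P) → does P? ≡ true → P
dec-true⁻¹ (yes p) _ = p

module _ {n : ℕ} where

  stars : SimpleGraph n → ℕ → Collection n
  stars G t v L = does (isStar? G t v L)

  #stars≡size : ∀ (G : SimpleGraph n) t → #stars G t ≡ size (stars G t)
  #stars≡size G t = trans (length-filter≡count (λ _ → refl) (allPairs n)) (sym (size≡count (stars G t)))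

  nonempty-if-size-pos : ∀ (H : Collection n) → 0 ℕ.< size H → Σ[ v ∈ Fin n ] Σ[ L ∈ Subset n ] H v L ≡ true
  nonempty-if-size-pos H 0<size =
    let ((v , L) , Hv) = count-witness (allPairs n) (subst (0 ℕ.<_) (size≡count H) 0<size)
    in  v , L , Hv

  centre-occupied : ∀ (H : Collection n) {v L} → H v L ≡ true → 0 ℕ.< #centeredAt H v
  centre-occupied H {v} {L} HvL = subst (0 ℕ.<_) (sym (#centeredAt≡count H v)) (count-pos (∈-allSubsets L) HvL)

  leaf-occupied : ∀ (H : Collection n) {v L u} → H v L ≡ true → u ∈ L → 0 ℕ.< #leafAt H u
  leaf-occupied H {v} {L} {u} HvL u∈L = subst (0 ℕ.<_) (sym (#leafAt≡count H u))
    (count-pos (∈-allPairs v L) (cong₂ _∧_ HvL (dec-true (u ∈? L) u∈L)))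

  support : (Fin n → ℕ) → Subset n
  support f = Vec.tabulate (λ v → 0 <ᵇ f v)

  ∈-support⁺ : ∀ f {v} → 0 ℕ.< f v → v ∈ support f
  ∈-support⁺ f {v} 0<fv = lookup⇒[]= v (support f) (trans (lookup∘tabulate (λ w → 0 <ᵇ f w) v) (0<⇒0<ᵇ 0<fv))

  ∈-support⁻ : ∀ f {v} → v ∈ support f → 0 ℕ.< f v
  ∈-support⁻ f {v} v∈ = 0<ᵇ⇒0< (trans (sym (lookup∘tabulate (λ w → 0 <ᵇ f w) v)) ([]=⇒lookup v∈))

ℕ→ℚ≡mkℚ : ∀ m → ℕ→ℚ m ≡ mkℚ (ℤ.+ m) 0 (coprime-sym (1-coprimeTo m))
ℕ→ℚ≡mkℚ m = normalize-coprime (coprime-sym (1-coprimeTo m))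

ℕ→ℚ≤mkℚ : ∀ {m a d-1} .{c : Coprime a (suc d-1)} → m ℕ.* suc d-1 ℕ.≤ a → ℕ→ℚ m ≤ mkℚ (ℤ.+ a) d-1 c
ℕ→ℚ≤mkℚ {m} {a} {d-1} m*d≤a rewrite ℕ→ℚ≡mkℚ m =
  *≤* (subst₂ ℤ._≤_ (pos-* m (suc d-1)) (pos-* a 1) (+≤+ (≤-trans m*d≤a (≤-reflexive (sym (*-identityʳ a))))))

mkℚ<ℕ→ℚ : ∀ {m a d-1} .{c : Coprime a (suc d-1)} → a ℕ.< m ℕ.* suc d-1 → mkℚ (ℤ.+ a) d-1 c < ℕ→ℚ m
mkℚ<ℕ→ℚ {m} {a} {d-1} a<m*d rewrite ℕ→ℚ≡mkℚ m =
  *<* (subst₂ ℤ._<_ (pos-* a 1) (pos-* m (suc d-1)) (+<+ (<-≤-trans (s≤s (≤-reflexive (*-identityʳ a))) a<m*d)))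

ℕ→ℚ-mono : ∀ {m n} → m ℕ.≤ n → ℕ→ℚ m ≤ ℕ→ℚ n
ℕ→ℚ-mono {m} {n} m≤n = subst (ℕ→ℚ m ≤_) (sym (ℕ→ℚ≡mkℚ n)) (ℕ→ℚ≤mkℚ {m} (≤-trans (≤-reflexive (*-identityʳ m)) m≤n))

ℕ→ℚ-+ : ∀ m n → ℕ→ℚ (m ℕ.+ n) ≡ ℕ→ℚ m + ℕ→ℚ n
ℕ→ℚ-+ m n rewrite ℕ→ℚ≡mkℚ m | ℕ→ℚ≡mkℚ n =
  cong (ℚ._/ 1) (cong₂ ℤ._+_ (sym (ℤ.*-identityʳ (ℤ.+ m))) (sym (ℤ.*-identityʳ (ℤ.+ n))))

ℕ→ℚ-* : ∀ m n → ℕ→ℚ (m ℕ.* n) ≡ ℕ→ℚ m * ℕ→ℚ n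
ℕ→ℚ-* m n rewrite ℕ→ℚ≡mkℚ m | ℕ→ℚ≡mkℚ n = cong (ℚ._/ 1) (pos-* m n)

-- Negative rationals have junk value 0.
⌊_⌋ₙ : ℚ → ℕ
⌊ mkℚ (ℤ.+ a) d-1 _ ⌋ₙ = a / suc d-1
⌊ mkℚ -[1+ _ ] _ _ ⌋ₙ = 0

⌊q⌋ₙ≤q : ∀ q → 0ℚ ≤ q → ℕ→ℚ ⌊ q ⌋ₙ ≤ q
⌊q⌋ₙ≤q (mkℚ (ℤ.+ a) d-1 _) _ = ℕ→ℚ≤mkℚ {a / suc d-1} (m/n*n≤m a (suc d-1))
⌊q⌋ₙ≤q (mkℚ -[1+ _ ] _ _) (*≤* ())

q<1+⌊q⌋ₙ : ∀ q → q < ℕ→ℚ (suc ⌊ q ⌋ₙ)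
q<1+⌊q⌋ₙ (mkℚ (ℤ.+ a) d-1 _) = mkℚ<ℕ→ℚ {suc (a / d)} a<d+[a/d]*d
  where
  d = suc d-1
  a<d+[a/d]*d : a ℕ.< d ℕ.+ a / d ℕ.* d
  a<d+[a/d]*d = subst (ℕ._< d ℕ.+ a / d ℕ.* d) (sym (m≡m%n+[m/n]*n a d)) (+-monoˡ-< (a / d ℕ.* d) (m%n<n a d))
q<1+⌊q⌋ₙ (mkℚ -[1+ _ ] _ _) = *<* ℤ.-<+

0<ℕ→ℚ : ∀ {n} → 0 ℕ.< n → 0ℚ < ℕ→ℚ n
0<ℕ→ℚ 0<n = ℚ.<-≤-trans (positive⁻¹ 1ℚ) (ℕ→ℚ-mono 0<n)

0<ℕ→ℚ⁻¹ : ∀ {n} → 0ℚ < ℕ→ℚ n → 0 ℕ.< n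
0<ℕ→ℚ⁻¹ {zero} 0<0 = contradiction 0<0 (ℚ.<-irrefl refl)
0<ℕ→ℚ⁻¹ {suc n} _ = z<s

*-pos : ∀ {p q} → 0ℚ < p → 0ℚ < q → 0ℚ < p * q
*-pos {p} {q} 0<p 0<q = positive⁻¹ (p * q) {{pos*pos⇒pos p {{positive 0<p}} q {{positive 0<q}}}}

^ℚ-pos : ∀ k {q} → 0ℚ < q → 0ℚ < q ^ℚ k
^ℚ-pos zero    _   = positive⁻¹ 1ℚ
^ℚ-pos (suc k) 0<q = *-pos 0<q (^ℚ-pos k 0<q)

0<C*nᵏ*pˡ : ∀ {C p n} → 0ℚ < C → 0 ℕ.< n → 0ℚ < p → ∀ k l → 0ℚ < C * (ℕ→ℚ n ^ℚ k) * (p ^ℚ l)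
0<C*nᵏ*pˡ 0<C 0<n 0<p k l = *-pos (*-pos 0<C (^ℚ-pos k (0<ℕ→ℚ 0<n))) (^ℚ-pos l 0<p)

≤-threshold : ∀ {X b k} → X < ℕ→ℚ (suc b) → k ≡ 0 ⊎ b ℕ.< k → 0 ℕ.< k → X ≤ ℕ→ℚ k
≤-threshold _     (inj₁ refl) ()
≤-threshold X<1+b (inj₂ b<k) _ = ℚ.<⇒≤ (ℚ.<-≤-trans X<1+b (ℕ→ℚ-mono b<k))

open +-*-Solver

+-cancelʳ-≤ : ∀ r {p q} → p + r ≤ q + r → p ≤ q
+-cancelʳ-≤ r {p} {q} p+r≤q+r =
  subst₂ _≤_ (cancel p r) (cancel q r) (ℚ.+-monoˡ-≤ (- r) p+r≤q+r)
  where
  cancel : ∀ x y → x + y + - y ≡ x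
  cancel = solve 2 (λ x y → x :+ y :+ :- y := x) refl

third-remains : ∀ {C Nᵗ P : ℚ} {n b s₀ s : ℕ} → ℕ→ℚ b ≤ C * Nᵗ * P →
                ℕ→ℚ 3 * C * (ℕ→ℚ n * Nᵗ) * P ≤ ℕ→ℚ s₀ → s₀ ℕ.≤ s ℕ.+ (n ℕ.+ n) ℕ.* b →
                C * (ℕ→ℚ n * Nᵗ) * P ≤ ℕ→ℚ s
third-remains {C} {Nᵗ} {P} {n} {b} {s₀} {s} b≤X 3Y≤s₀ s₀≤s+2nb = +-cancelʳ-≤ (Y + Y) (begin
  Y + (Y + Y)                       ≡⟨ triple C n′ Nᵗ P ⟩
  ℕ→ℚ 3 * C * (n′ * Nᵗ) * P         ≤⟨ 3Y≤s₀ ⟩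
  ℕ→ℚ s₀                            ≤⟨ ℕ→ℚ-mono s₀≤s+2nb ⟩
  ℕ→ℚ (s ℕ.+ (n ℕ.+ n) ℕ.* b)      ≡⟨ ℕ→ℚ-+ s _ ⟩
  ℕ→ℚ s + ℕ→ℚ ((n ℕ.+ n) ℕ.* b)    ≡⟨ cong (ℕ→ℚ s +_) (ℕ→ℚ-* (n ℕ.+ n) b) ⟩
  ℕ→ℚ s + ℕ→ℚ (n ℕ.+ n) * ℕ→ℚ b    ≡⟨ cong (λ m → ℕ→ℚ s + m * ℕ→ℚ b) (ℕ→ℚ-+ n n) ⟩
  ℕ→ℚ s + (n′ + n′) * ℕ→ℚ b         ≤⟨ ℚ.+-monoʳ-≤ (ℕ→ℚ s) (*-monoˡ-≤-nonNeg (n′ + n′) {{0≤2n}} b≤X) ⟩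
  ℕ→ℚ s + (n′ + n′) * (C * Nᵗ * P)  ≡⟨ cong (ℕ→ℚ s +_) (double C n′ Nᵗ P) ⟩
  ℕ→ℚ s + (Y + Y)                   ∎)
  where
  open ℚ.≤-Reasoning
  n′ Y : ℚ
  n′ = ℕ→ℚ n
  Y = C * (n′ * Nᵗ) * P
  0≤2n : ℚ.NonNegative (n′ + n′)
  0≤2n = nonNegative (ℚ.+-mono-≤ (ℕ→ℚ-mono {0} {n} z≤n) (ℕ→ℚ-mono {0} {n} z≤n))
  triple : ∀ c m mᵗ q → c * (m * mᵗ) * q + (c * (m * mᵗ) * q + c * (m * mᵗ) * q) ≡ ℕ→ℚ 3 * c * (m * mᵗ) * q
  triple = solve 4 (λ c m mᵗ q → c :* (m :* mᵗ) :* q :+ (c :* (m :* mᵗ) :* q :+ c :* (m :* mᵗ) :* q)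
                                 := (con 1ℚ :+ con 1ℚ :+ con 1ℚ) :* c :* (m :* mᵗ) :* q) refl
  double : ∀ c m mᵗ q → (m + m) * (c * mᵗ * q) ≡ c * (m * mᵗ) * q + c * (m * mᵗ) * q
  double = solve 4 (λ c m mᵗ q → (m :+ m) :* (c :* mᵗ :* q) := c :* (m :* mᵗ) :* q :+ c :* (m :* mᵗ) :* q) refl

lemma2p4 : (t : ℕ) → t ≥ 1 → (C p : ℚ) → 0ℚ < C → 0ℚ < p →
  (n : ℕ) → n ≥ 1 → (G : SimpleGraph n) →
  ℕ→ℚ 3 * C * (ℕ→ℚ n ^ℚ suc t) * (p ^ℚ t) ≤ ℕ→ℚ (#stars G t) →
  Σ[ H ∈ Collection n ] Σ[ L₁ ∈ Subset n ] Σ[ L₂ ∈ Subset n ]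
    (Σ[ v ∈ Fin n ] Σ[ L ∈ Subset n ] H v L ≡ true)
    × (∀ v L → H v L ≡ true → IsStar G t v L)
    × (∀ v L → H v L ≡ true → (v ∈ L₁) × (L ⊆ L₂))
    × (C * (ℕ→ℚ n ^ℚ suc t) * (p ^ℚ t) ≤ ℕ→ℚ (size H))
    × (∀ v → v ∈ L₁ → C * (ℕ→ℚ n ^ℚ t) * (p ^ℚ t) ≤ ℕ→ℚ (#centeredAt H v))
    × (∀ u → u ∈ L₂ → C * (ℕ→ℚ n ^ℚ t) * (p ^ℚ t) ≤ ℕ→ℚ (#leafAt H u))
lemma2p4 t _ C p 0<C 0<p n 0<n G many-stars =
  kept , support (#centeredAt kept) , support (#leafAt kept)
  , nonempty-if-size-pos kept (0<ℕ→ℚ⁻¹ (ℚ.<-≤-trans (0<C*nᵏ*pˡ 0<C 0<n 0<p (suc t) t) many-kept))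
  , (λ v L HvL → dec-true⁻¹ (isStar? G t v L) (kept⊆H₀ v L HvL))
  , (λ v L HvL → ∈-support⁺ (#centeredAt kept) (centre-occupied kept HvL)
               , λ u∈L → ∈-support⁺ (#leafAt kept) (leaf-occupied kept HvL u∈L))
  , many-kept
  , (λ v v∈L₁ → ≤-threshold (q<1+⌊q⌋ₙ X) (centres v) (∈-support⁻ (#centeredAt kept) v∈L₁))
  , (λ u u∈L₂ → ≤-threshold (q<1+⌊q⌋ₙ X) (leaves u) (∈-support⁻ (#leafAt kept) u∈L₂))
  where
  n′ X : ℚ
  n′ = ℕ→ℚ n
  X = C * (n′ ^ℚ t) * (p ^ℚ t)

  b : ℕ
  b = ⌊ X ⌋ₙ

  open Pruned (prune (stars G t) b)

  many-kept : C * (n′ ^ℚ suc t) * (p ^ℚ t) ≤ ℕ→ℚ (size kept)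
  many-kept = third-remains {C} {n′ ^ℚ t} {p ^ℚ t} {n} (⌊q⌋ₙ≤q X (ℚ.<⇒≤ (0<C*nᵏ*pˡ 0<C 0<n 0<p t t)))
    (subst (λ s₀ → ℕ→ℚ 3 * C * (n′ ^ℚ suc t) * (p ^ℚ t) ≤ ℕ→ℚ s₀) (#stars≡size G t) many-stars) loss
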